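{- Let $n\ge3$ and $d\ge2$. The group $\mathbb{X}$ is contained in the group generated by $\mathbb{R}_d\cup\mathbb{F}_n$ if and only if $d$ is odd.
   Context: Let $[n]=\{0,\dots,n-1\}$; maps act on $[n]^d$. $\mathbb{R}_d$ is the group generated by the maps $R_{ij}$ ($i\ne j$ in $\{1,\dots,d\}$), where $R_{ij}([x_1,\dots,x_d])$ has $i$-th coordinate $n-x_j-1$, $j$-th coordinate $x_i$, and other coordinates unchanged. $\mathbb{F}_n$ is the group of maps $F_\pi([x_1,\dots,x_d])=[\pi(x_1),\dots,\pi(x_d)]$ for permutations $\pi$ of $[n]$ with $\pi(n-p-1)=n-\pi(p)-1$ for all $p$. $\mathbb{X}=\{\mathit{Id},X\}$ with $X([x_1,\dots,x_{d-1},x_d])=[x_1,\dots,x_d,x_{d-1}]$. -}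

module Defs where

open import Data.Nat using (ℕ; zero; suc)
open import Data.Fin using (Fin; opposite)
open import Data.Vec using (Vec; []; _∷_; lookup; map; _[_]≔_)
open import Data.Fin.Permutation using (Permutation′; _⟨$⟩ʳ_)
open import Data.Product using (Σ; ∃; _×_; _,_)
open import Relation.Binary.PropositionalEquality using (_≡_)
open import Relation.Nullary using (¬_)

Pt : ℕ → ℕ → Set
Pt n d = Vec (Fin n) d

Map : ℕ → ℕ → Set
Map n d = Pt n d → Pt n d

_≈_ : ∀ {n d} → Map n d → Map n d → Set
f ≈ g = ∀ x → f x ≡ g x

idMap : ∀ {n d} → Map n d
idMap x = x

_∘M_ : ∀ {n d} → Map n d → Map n d → Map n d
(f ∘M g) x = f (g x)

-- R_ij (i ≠ j): i-th coordinate becomes n - x_j - 1, j-th becomes x_i.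
-- (opposite p = n - 1 - p on Fin n.)
R : ∀ {n d} → Fin d → Fin d → Map n d
R i j x = (x [ i ]≔ opposite (lookup x j)) [ j ]≔ lookup x i

Symmetric : ∀ {n} → Permutation′ n → Set
Symmetric {n} π = ∀ (p : Fin n) → π ⟨$⟩ʳ opposite p ≡ opposite (π ⟨$⟩ʳ p)

F : ∀ {n d} → Permutation′ n → Map n d
F π x = map (π ⟨$⟩ʳ_) x

-- Swap the last two coordinates (identity if d < 2).
swapLast : ∀ {A : Set} {d} → Vec A d → Vec A d
swapLast []               = []
swapLast (a ∷ [])         = a ∷ []
swapLast (a ∷ b ∷ [])     = b ∷ a ∷ []
swapLast (a ∷ b ∷ c ∷ xs) = a ∷ swapLast (b ∷ c ∷ xs)

X : ∀ {n d} → Map n d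
X = swapLast

data Gen (n d : ℕ) : Map n d → Set where
  genR : ∀ (i j : Fin d) → ¬ (i ≡ j) → Gen n d (R i j)
  genF : ∀ (π : Permutation′ n) → Symmetric π → Gen n d (F π)

-- The group generated by Gen (subgroup of the bijections of [n]^d), as an
-- inductive predicate on maps, closed under extensional equality.
data InGroup (n d : ℕ) : Map n d → Set where
  gen  : ∀ {f} → Gen n d f → InGroup n d f
  unit : InGroup n d idMap
  comp : ∀ {f g} → InGroup n d f → InGroup n d g → InGroup n d (f ∘M g)
  inv  : ∀ {f g} → InGroup n d f → (g ∘M f) ≈ idMap → (f ∘M g) ≈ idMap →
         InGroup n d g
  ext  : ∀ {f g} → InGroup n d f → f ≈ g → InGroup n d g

-- The group 𝕏 = {Id, X} is contained in the generated group.
XContained : ℕ → ℕ → Set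
XContained n d = InGroup n d idMap × InGroup n d X

module Submission where

-- Odd d: R₀₂R₀₂R₁₂ reflects all three coordinates of [n]^3 and exchanges the
-- last two, and R₀₁R₀₁ reflects the first two coordinates; by induction in
-- steps of two, a product of rotations reflects every coordinate and exchanges
-- the last two.  Composing with F for π = reverse (p ↦ n-1-p) yields X.
--
-- Even d: every generator maps the reflection of one coordinate to the
-- reflection of one coordinate.  We write group elements as words and track,
-- for a word w, the permutation of coordinates by which it moves these
-- single-coordinate reflections.  Starting from
-- a point a whose coordinates are z or its reflection z̄ ≠ z, the point w·a
-- again takes two reflected values p, p̄, and
--     sign (coordinate permutation of w) + parity of #{k | (w·a)_k = p}
-- is invariant: a rotation R_ij composes the permutation with a transposition
-- and changes the count by one, a relabelling changes neither.  For the
-- constant point a = (0,…,0) and w = X, the point a is fixed, all counts are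
-- even, but the coordinate permutation is a transposition: a contradiction.

open import Defs
open import Data.Nat using (ℕ; _≤_; _%_)
open import Relation.Binary.PropositionalEquality using (_≡_)
open import Function.Bundles using (_⇔_)

open import Data.Nat using (zero; suc; s≤s)
open import Data.Bool using (Bool; true; false; not; _∧_; _xor_)
open import Data.Bool.Properties
  using (xor-∧-commutativeRing; xor-same; xor-identityʳ; xor-comm; xor-assoc; xor-annihilates-not;
         ∧-zeroʳ; ∧-identityʳ; not-¬)
open import Data.Fin using (Fin; zero; suc; _<_; punchIn; opposite)
open import Data.Fin.Properties
  using (_≟_; _<?_; <-cmp; <-trans; <-asym; <-irrefl; punchInᵢ≢i; suc-injective; opposite-involutive)
open import Data.Fin.Permutation
  using (Permutation′; _⟨$⟩ʳ_; _⟨$⟩ˡ_; inverseʳ; inverseˡ; id; flip; _∘ₚ_; reverse; lift₀-transpose)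
  renaming (transpose to transposition)
open import Data.Fin.Permutation.Components using (transpose; transpose-inverse)
open import Data.Vec using ([]; _∷_; lookup; tabulate; replicate; map; _[_]≔_)
open import Data.Vec.Properties
  using (lookup∘update; lookup∘update′; lookup∘tabulate; tabulate∘lookup; tabulate-cong;
         lookup-replicate; lookup-map; map-[]≔; []≔-idempotent; []≔-commutes; []≔-lookup)
open import Data.List using (List; []; _∷_; _++_) renaming (map to mapList)
open import Data.Product using (Σ; _,_; proj₁; proj₂)
open import Data.Sum using (_⊎_; inj₁; inj₂) renaming (map to map-⊎)
open import Data.Empty using (⊥-elim)
open import Relation.Binary.PropositionalEquality
  using (_≢_; refl; sym; trans; cong; cong₂; subst; module ≡-Reasoning)
open import Relation.Binary.Definitions using (tri<; tri≈; tri>)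
open import Relation.Nullary using (¬_; yes; no; does)
open import Relation.Nullary.Decidable using (dec-true; dec-false; does-⇔)
open import Function.Base using (_∘_)
open import Function.Bundles using (mk⇔)
open import Algebra.Bundles using (CommutativeRing)
open import Algebra.Solver.Ring.AlmostCommutativeRing using (fromCommutativeRing)
import Algebra.Solver.Ring.Simple as RingSolver
open import Algebra.Definitions using (Involutive)

-- Booleans under xor and ∧ form the field with two elements; parities of
-- finite counts are sums in it.
open CommutativeRing xor-∧-commutativeRing using (semiring)
open import Algebra.Properties.Semiring.Sum semiring
  using (sum; sum-cong-≗; sum-remove; ∑-distrib-+; *-distribˡ-sum; ∑-permute; sum-replicate-zero)
open RingSolver (fromCommutativeRing xor-∧-commutativeRing) Data.Bool._≟_
  using (solve; _:=_; _:+_; _:*_)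

sum-zero : ∀ {d} (h : Fin d → Bool) → (∀ k → h k ≡ false) → sum h ≡ false
sum-zero {d} h h≡0 = trans (sum-cong-≗ h≡0) (sum-replicate-zero d)

sum-indicator : ∀ {d} (a : Fin d) → sum (λ k → does (k ≟ a)) ≡ true
sum-indicator {suc d} a = trans (sum-remove {i = a} (λ k → does (k ≟ a)))
  (cong₂ _xor_ (dec-true (a ≟ a) refl)
               (sum-zero _ (λ k → dec-false (punchIn a k ≟ a) (punchInᵢ≢i a k))))

xor-cancel : ∀ x s → (x xor s) xor x ≡ s
xor-cancel false s     = xor-identityʳ s
xor-cancel true  false = refl
xor-cancel true  true  = refl

xor-interchange : ∀ w x y z → (w xor x) xor (y xor z) ≡ (w xor y) xor (x xor z)
xor-interchange = solve 4 (λ w x y z → (w :+ x) :+ (y :+ z) := (w :+ y) :+ (x :+ z)) refl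

sum-update : ∀ {d} (h h′ : Fin d → Bool) (i : Fin d) →
             (∀ k → k ≢ i → h k ≡ h′ k) → sum h′ ≡ (sum h xor h i) xor h′ i
sum-update {suc d} h h′ i same = begin
  sum h′                      ≡⟨ sum-remove {i = i} h′ ⟩
  h′ i xor rest′              ≡⟨ cong (h′ i xor_) (sum-cong-≗ (λ k → sym (same _ (punchInᵢ≢i i k)))) ⟩
  h′ i xor rest               ≡⟨ xor-comm (h′ i) rest ⟩
  rest xor h′ i               ≡⟨ cong (_xor h′ i) (sym (xor-cancel (h i) rest)) ⟩
  ((h i xor rest) xor h i) xor h′ i ≡⟨ cong (λ s → (s xor h i) xor h′ i) (sym (sum-remove {i = i} h)) ⟩
  (sum h xor h i) xor h′ i    ∎
  where
  open ≡-Reasoning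
  rest  = sum (λ k → h (punchIn i k))
  rest′ = sum (λ k → h′ (punchIn i k))

data Location {m} (i j k : Fin m) : Set where
  at-first  : k ≡ i → Location i j k
  at-second : k ≢ i → k ≡ j → Location i j k
  elsewhere : k ≢ i → k ≢ j → Location i j k

locate : ∀ {m} (i j k : Fin m) → Location i j k
locate i j k with k ≟ i | k ≟ j
... | yes k≡i | _       = at-first k≡i
... | no  k≢i | yes k≡j = at-second k≢i k≡j
... | no  k≢i | no  k≢j = elsewhere k≢i k≢j

module _ {m : ℕ} where

  transpose-left : ∀ (i j : Fin m) → transpose i j i ≡ j
  transpose-left i j rewrite dec-true (i ≟ i) refl = refl

  transpose-right : ∀ (i j : Fin m) → transpose i j j ≡ i
  transpose-right i j with j ≟ i
  ... | yes j≡i = j≡i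
  ... | no  _   rewrite dec-true (j ≟ j) refl = refl

  transpose-other : ∀ {i j k : Fin m} → k ≢ i → k ≢ j → transpose i j k ≡ k
  transpose-other {i} {j} {k} k≢i k≢j rewrite dec-false (k ≟ i) k≢i | dec-false (k ≟ j) k≢j = refl

  transpose-comm : ∀ (i j k : Fin m) → transpose i j k ≡ transpose j i k
  transpose-comm i j k with locate i j k
  ... | at-first refl       = trans (transpose-left k j) (sym (transpose-right j k))
  ... | at-second _ refl    = trans (transpose-right i k) (sym (transpose-left k i))
  ... | elsewhere k≢i k≢j   = trans (transpose-other k≢i k≢j) (sym (transpose-other k≢j k≢i))

  transpose-involutive : ∀ (i j k : Fin m) → transpose i j (transpose i j k) ≡ k
  transpose-involutive i j k =
    trans (cong (transpose i j) (transpose-comm i j k)) (transpose-inverse i j)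

_<ᵇ_ : ∀ {m} → Fin m → Fin m → Bool
x <ᵇ y = does (x <? y)

<ᵇ-true : ∀ {m} (x y : Fin m) → x < y → x <ᵇ y ≡ true
<ᵇ-true x y = dec-true (x <? y)

<ᵇ-false : ∀ {m} (x y : Fin m) → ¬ x < y → x <ᵇ y ≡ false
<ᵇ-false x y = dec-false (x <? y)

-- The parity of the number of inversions of a sequence f, i.e. of pairs of
-- positions k < l with f l < f k.  For a permutation this is its sign.
inversions : ∀ {d m} → (Fin d → Fin m) → Bool
inversions {zero}  f = false
inversions {suc d} f = sum (λ k → f (suc k) <ᵇ f zero) xor inversions (f ∘ suc)

inversions-cong : ∀ {d m} {f g : Fin d → Fin m} → (∀ k → f k ≡ g k) → inversions f ≡ inversions g
inversions-cong {zero}  f≗g = refl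
inversions-cong {suc d} f≗g =
  cong₂ _xor_ (sum-cong-≗ (λ k → cong₂ _<ᵇ_ (f≗g (suc k)) (f≗g zero))) (inversions-cong (f≗g ∘ suc))

occurs-once : ∀ {m} (σ : Permutation′ m) v → sum (λ k → does (σ ⟨$⟩ʳ k ≟ v)) ≡ true
occurs-once σ v = trans (sym (∑-permute (λ k → does (k ≟ v)) σ)) (sum-indicator v)

xor-true : ∀ x y → x xor y ≡ true → x ≡ not y
xor-true false true  _ = refl
xor-true true  false _ = refl

-- Entries of a sequence fall into three classes; given the parities α, β, γ
-- of the class sizes, the parity of the number of pairs of entries lying in
-- two different classes.
pairs : Bool → Bool → Bool → Bool
pairs α β γ = (α ∧ β) xor ((α ∧ γ) xor (β ∧ γ))

-- The parity of the number of such mixed pairs between one entry of class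
-- indicator (α, β, γ) and entries of class parities (A, B, C).
cross : Bool → Bool → Bool → Bool → Bool → Bool → Bool
cross α β γ A B C = (α ∧ (B xor C)) xor ((β ∧ (A xor C)) xor (γ ∧ (A xor B)))

-- Adding one entry to a sequence (a ring identity; the last summand counts
-- the pairs within the new entry's own indicator and vanishes when the
-- classes are exclusive).
pairs-cons : ∀ α β γ A B C →
             pairs (α xor A) (β xor B) (γ xor C) ≡ (cross α β γ A B C xor pairs A B C) xor pairs α β γ
pairs-cons = solve 6 (λ α β γ A B C →
  ((α :+ A) :* (β :+ B)) :+ (((α :+ A) :* (γ :+ C)) :+ ((β :+ B) :* (γ :+ C)))
  := (((α :* (B :+ C)) :+ ((β :* (A :+ C)) :+ (γ :* (A :+ B)))) :+ ((A :* B) :+ ((A :* C) :+ (B :* C))))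
     :+ ((α :* β) :+ ((α :* γ) :+ (β :* γ)))) refl

pairs-cong : ∀ {α β γ α′ β′ γ′} → α ≡ α′ → β ≡ β′ → γ ≡ γ′ → pairs α β γ ≡ pairs α′ β′ γ′
pairs-cong refl refl refl = refl

cross-cong : ∀ {α β γ α′ β′ γ′} A B C → α ≡ α′ → β ≡ β′ → γ ≡ γ′ → cross α β γ A B C ≡ cross α′ β′ γ′ A B C
cross-cong A B C refl refl refl = refl

-- Exchanging two values a < b in an arbitrary sequence f changes its
-- inversion parity by AB + AC + BC, where A, B and C are the parities of the
-- numbers of entries equal to a, equal to b, and strictly between a and b.
module ValueSwap {m} {a b : Fin m} (a<b : a < b) where
  open ≡-Reasoning

  τ : Fin m → Fin m
  τ = transpose a b

  isA isB inside : Fin m → Bool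
  isA y    = does (y ≟ a)
  isB y    = does (y ≟ b)
  inside y = (a <ᵇ y) ∧ (y <ᵇ b)

  A B C : ∀ {d} → (Fin d → Fin m) → Bool
  A f = sum (isA ∘ f)
  B f = sum (isB ∘ f)
  C f = sum (inside ∘ f)

  a≢b : a ≢ b
  a≢b refl = <-irrefl refl a<b

  <ᵇ-irrefl : ∀ (x : Fin m) → x <ᵇ x ≡ false
  <ᵇ-irrefl x = <ᵇ-false x x (<-irrefl refl)

  isA-a : isA a ≡ true
  isA-a = dec-true (a ≟ a) refl

  isB-a : isB a ≡ false
  isB-a = dec-false (a ≟ b) a≢b

  isA-b : isA b ≡ false
  isA-b = dec-false (b ≟ a) (a≢b ∘ sym)

  isB-b : isB b ≡ true
  isB-b = dec-true (b ≟ b) refl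

  inside-a : inside a ≡ false
  inside-a = cong (_∧ (a <ᵇ b)) (<ᵇ-irrefl a)

  inside-b : inside b ≡ false
  inside-b = trans (cong ((a <ᵇ b) ∧_) (<ᵇ-irrefl b)) (∧-zeroʳ _)

  below-b-not-a : ∀ {y} → y ≢ a → (y <ᵇ b) xor (y <ᵇ a) ≡ inside y
  below-b-not-a {y} y≢a with <-cmp y a
  ... | tri< y<a _ _ rewrite <ᵇ-true y b (<-trans y<a a<b) | <ᵇ-true y a y<a | <ᵇ-false a y (<-asym y<a) = refl
  ... | tri≈ _ y≡a _ = ⊥-elim (y≢a y≡a)
  ... | tri> _ _ a<y rewrite <ᵇ-false y a (<-asym a<y) | <ᵇ-true a y a<y = xor-identityʳ _

  above-a-not-b : ∀ {x} → x ≢ b → (b <ᵇ x) xor (a <ᵇ x) ≡ inside x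
  above-a-not-b {x} x≢b with <-cmp x b
  ... | tri< x<b _ _ rewrite <ᵇ-false b x (<-asym x<b) | <ᵇ-true x b x<b = sym (∧-identityʳ _)
  ... | tri≈ _ x≡b _ = ⊥-elim (x≢b x≡b)
  ... | tri> _ _ b<x rewrite <ᵇ-true b x b<x | <ᵇ-true a x (<-trans a<b b<x) | <ᵇ-false x b (<-asym b<x) = refl

  Crossing-at-a Crossing-at-b : Fin m → Set
  Crossing-at-a y = (τ y <ᵇ τ a) xor (y <ᵇ a) ≡ isB y xor inside y
  Crossing-at-b y = (τ y <ᵇ τ b) xor (y <ᵇ b) ≡ isA y xor inside y

  Crossing-elsewhere : Fin m → Fin m → Set
  Crossing-elsewhere x y = (τ y <ᵇ τ x) xor (y <ᵇ x) ≡ inside x ∧ (isA y xor isB y)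

  crossing-at-a : ∀ y → Crossing-at-a y
  crossing-at-a y with locate a b y
  ... | at-first y≡a = subst Crossing-at-a (sym y≡a)
    (trans (cong₂ _xor_ (<ᵇ-irrefl (τ a)) (<ᵇ-irrefl a)) (sym (cong₂ _xor_ isB-a inside-a)))
  ... | at-second _ y≡b = subst Crossing-at-a (sym y≡b) (trans
    (cong₂ _xor_ (trans (cong₂ _<ᵇ_ (transpose-right a b) (transpose-left a b)) (<ᵇ-true a b a<b))
                 (<ᵇ-false b a (<-asym a<b)))
    (sym (cong₂ _xor_ isB-b inside-b)))
  ... | elsewhere y≢a y≢b = begin
    (τ y <ᵇ τ a) xor (y <ᵇ a) ≡⟨ cong₂ (λ u v → (u <ᵇ v) xor (y <ᵇ a)) (transpose-other y≢a y≢b) (transpose-left a b) ⟩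
    (y <ᵇ b) xor (y <ᵇ a)     ≡⟨ below-b-not-a y≢a ⟩
    inside y                  ≡⟨ cong (_xor inside y) (dec-false (y ≟ b) y≢b) ⟨
    isB y xor inside y        ∎

  crossing-at-b : ∀ y → Crossing-at-b y
  crossing-at-b y with locate a b y
  ... | at-first y≡a = subst Crossing-at-b (sym y≡a) (trans
    (cong₂ _xor_ (trans (cong₂ _<ᵇ_ (transpose-left a b) (transpose-right a b)) (<ᵇ-false b a (<-asym a<b)))
                 (<ᵇ-true a b a<b))
    (sym (cong₂ _xor_ isA-a inside-a)))
  ... | at-second _ y≡b = subst Crossing-at-b (sym y≡b)
    (trans (cong₂ _xor_ (<ᵇ-irrefl (τ b)) (<ᵇ-irrefl b)) (sym (cong₂ _xor_ isA-b inside-b)))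
  ... | elsewhere y≢a y≢b = begin
    (τ y <ᵇ τ b) xor (y <ᵇ b) ≡⟨ cong₂ (λ u v → (u <ᵇ v) xor (y <ᵇ b)) (transpose-other y≢a y≢b) (transpose-right a b) ⟩
    (y <ᵇ a) xor (y <ᵇ b)     ≡⟨ xor-comm (y <ᵇ a) (y <ᵇ b) ⟩
    (y <ᵇ b) xor (y <ᵇ a)     ≡⟨ below-b-not-a y≢a ⟩
    inside y                  ≡⟨ cong (_xor inside y) (dec-false (y ≟ a) y≢a) ⟨
    isA y xor inside y        ∎

  crossing-elsewhere : ∀ {x} → x ≢ a → x ≢ b → ∀ y → Crossing-elsewhere x y
  crossing-elsewhere {x} x≢a x≢b y with locate a b y
  ... | at-first y≡a = subst (Crossing-elsewhere x) (sym y≡a) (begin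
    (τ a <ᵇ τ x) xor (a <ᵇ x)   ≡⟨ cong₂ (λ u v → (u <ᵇ v) xor (a <ᵇ x)) (transpose-left a b) (transpose-other x≢a x≢b) ⟩
    (b <ᵇ x) xor (a <ᵇ x)       ≡⟨ above-a-not-b x≢b ⟩
    inside x                    ≡⟨ ∧-identityʳ (inside x) ⟨
    inside x ∧ (true xor false) ≡⟨ cong₂ (λ u v → inside x ∧ (u xor v)) isA-a isB-a ⟨
    inside x ∧ (isA a xor isB a) ∎)
  ... | at-second _ y≡b = subst (Crossing-elsewhere x) (sym y≡b) (begin
    (τ b <ᵇ τ x) xor (b <ᵇ x)   ≡⟨ cong₂ (λ u v → (u <ᵇ v) xor (b <ᵇ x)) (transpose-right a b) (transpose-other x≢a x≢b) ⟩
    (a <ᵇ x) xor (b <ᵇ x)       ≡⟨ xor-comm (a <ᵇ x) (b <ᵇ x) ⟩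
    (b <ᵇ x) xor (a <ᵇ x)       ≡⟨ above-a-not-b x≢b ⟩
    inside x                    ≡⟨ ∧-identityʳ (inside x) ⟨
    inside x ∧ (false xor true) ≡⟨ cong₂ (λ u v → inside x ∧ (u xor v)) isA-b isB-b ⟨
    inside x ∧ (isA b xor isB b) ∎)
  ... | elsewhere y≢a y≢b = begin
    (τ y <ᵇ τ x) xor (y <ᵇ x)   ≡⟨ cong₂ (λ u v → (u <ᵇ v) xor (y <ᵇ x)) (transpose-other y≢a y≢b) (transpose-other x≢a x≢b) ⟩
    (y <ᵇ x) xor (y <ᵇ x)       ≡⟨ xor-same (y <ᵇ x) ⟩
    false                       ≡⟨ ∧-zeroʳ (inside x) ⟨
    inside x ∧ (false xor false) ≡⟨ cong₂ (λ u v → inside x ∧ (u xor v)) (dec-false (y ≟ a) y≢a) (dec-false (y ≟ b) y≢b) ⟨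
    inside x ∧ (isA y xor isB y) ∎

  exclusive : ∀ x → pairs (isA x) (isB x) (inside x) ≡ false
  exclusive x with locate a b x
  ... | at-first x≡a = subst (λ x → pairs (isA x) (isB x) (inside x) ≡ false) (sym x≡a)
                             (pairs-cong isA-a isB-a inside-a)
  ... | at-second _ x≡b = subst (λ x → pairs (isA x) (isB x) (inside x) ≡ false) (sym x≡b)
                                (pairs-cong isA-b isB-b inside-b)
  ... | elsewhere x≢a x≢b = pairs-cong (dec-false (x ≟ a) x≢a) (dec-false (x ≟ b) x≢b) refl

  First-row : ∀ {d} → (Fin d → Fin m) → Fin m → Set
  First-row g x = sum (λ k → τ (g k) <ᵇ τ x) xor sum (λ k → g k <ᵇ x)
                ≡ cross (isA x) (isB x) (inside x) (A g) (B g) (C g)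

  first-row : ∀ {d} (g : Fin d → Fin m) x → First-row g x
  first-row g x = trans (sym (∑-distrib-+ (λ k → τ (g k) <ᵇ τ x) (λ k → g k <ᵇ x))) (by-location x)
    where
    Row : Fin m → Set
    Row x = sum (λ k → (τ (g k) <ᵇ τ x) xor (g k <ᵇ x)) ≡ cross (isA x) (isB x) (inside x) (A g) (B g) (C g)

    by-location : ∀ x → Row x
    by-location x with locate a b x
    ... | at-first x≡a = subst Row (sym x≡a) (begin
      sum (λ k → (τ (g k) <ᵇ τ a) xor (g k <ᵇ a)) ≡⟨ sum-cong-≗ (crossing-at-a ∘ g) ⟩
      sum (λ k → isB (g k) xor inside (g k))      ≡⟨ ∑-distrib-+ (isB ∘ g) (inside ∘ g) ⟩
      B g xor C g                                 ≡⟨ xor-identityʳ _ ⟨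
      cross true false false (A g) (B g) (C g)    ≡⟨ cross-cong (A g) (B g) (C g) isA-a isB-a inside-a ⟨
      cross (isA a) (isB a) (inside a) (A g) (B g) (C g) ∎)
    ... | at-second _ x≡b = subst Row (sym x≡b) (begin
      sum (λ k → (τ (g k) <ᵇ τ b) xor (g k <ᵇ b)) ≡⟨ sum-cong-≗ (crossing-at-b ∘ g) ⟩
      sum (λ k → isA (g k) xor inside (g k))      ≡⟨ ∑-distrib-+ (isA ∘ g) (inside ∘ g) ⟩
      A g xor C g                                 ≡⟨ xor-identityʳ _ ⟨
      cross false true false (A g) (B g) (C g)    ≡⟨ cross-cong (A g) (B g) (C g) isA-b isB-b inside-b ⟨
      cross (isA b) (isB b) (inside b) (A g) (B g) (C g) ∎)
    ... | elsewhere x≢a x≢b = begin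
      sum (λ k → (τ (g k) <ᵇ τ x) xor (g k <ᵇ x))      ≡⟨ sum-cong-≗ (crossing-elsewhere x≢a x≢b ∘ g) ⟩
      sum (λ k → inside x ∧ (isA (g k) xor isB (g k))) ≡⟨ *-distribˡ-sum (inside x) (λ k → isA (g k) xor isB (g k)) ⟨
      inside x ∧ sum (λ k → isA (g k) xor isB (g k))   ≡⟨ cong (inside x ∧_) (∑-distrib-+ (isA ∘ g) (isB ∘ g)) ⟩
      cross false false (inside x) (A g) (B g) (C g)   ≡⟨ cross-cong (A g) (B g) (C g)
                                                            (dec-false (x ≟ a) x≢a) (dec-false (x ≟ b) x≢b) refl ⟨
      cross (isA x) (isB x) (inside x) (A g) (B g) (C g) ∎

  swap-inversions : ∀ {d} (f : Fin d → Fin m) →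
                    inversions (τ ∘ f) xor inversions f ≡ pairs (A f) (B f) (C f)
  swap-inversions {zero}  f = refl
  swap-inversions {suc d} f = begin
    (S₁ xor I₁) xor (S₂ xor I₂)   ≡⟨ xor-interchange S₁ I₁ S₂ I₂ ⟩
    (S₁ xor S₂) xor (I₁ xor I₂)   ≡⟨ cong₂ _xor_ (first-row g x) (swap-inversions g) ⟩
    Δ xor Π                       ≡⟨ xor-identityʳ (Δ xor Π) ⟨
    (Δ xor Π) xor false           ≡⟨ cong ((Δ xor Π) xor_) (exclusive x) ⟨
    (Δ xor Π) xor pairs α β γ     ≡⟨ pairs-cons α β γ (A g) (B g) (C g) ⟨
    pairs (A f) (B f) (C f)       ∎
    where
    x = f zero
    g = f ∘ suc
    α = isA x
    β = isB x
    γ = inside x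
    S₁ = sum (λ k → τ (g k) <ᵇ τ x)
    S₂ = sum (λ k → g k <ᵇ x)
    I₁ = inversions (τ ∘ g)
    I₂ = inversions g
    Δ = cross α β γ (A g) (B g) (C g)
    Π = pairs (A g) (B g) (C g)

  -- In a permutation a and b each occur once, so exchanging them flips the
  -- inversion parity.
  swap-permutation : (σ : Permutation′ m) → inversions (τ ∘ (σ ⟨$⟩ʳ_)) ≡ not (inversions (σ ⟨$⟩ʳ_))
  swap-permutation σ = xor-true _ _ (begin
    inversions (τ ∘ (σ ⟨$⟩ʳ_)) xor inversions (σ ⟨$⟩ʳ_) ≡⟨ swap-inversions (σ ⟨$⟩ʳ_) ⟩
    pairs (A (σ ⟨$⟩ʳ_)) (B (σ ⟨$⟩ʳ_)) (C (σ ⟨$⟩ʳ_))      ≡⟨ pairs-cong (occurs-once σ a) (occurs-once σ b) refl ⟩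
    not (C (σ ⟨$⟩ʳ_) xor C (σ ⟨$⟩ʳ_))                     ≡⟨ cong not (xor-same (C (σ ⟨$⟩ʳ_))) ⟩
    true                                                  ∎)

sign : ∀ {d} → Permutation′ d → Bool
sign σ = inversions (σ ⟨$⟩ʳ_)

sign-transpose : ∀ {d} (σ : Permutation′ d) {i j} → i ≢ j → sign (σ ∘ₚ transposition i j) ≡ not (sign σ)
sign-transpose σ {i} {j} i≢j with <-cmp i j
... | tri< i<j _ _ = ValueSwap.swap-permutation i<j σ
... | tri≈ _ i≡j _ = ⊥-elim (i≢j i≡j)
... | tri> _ _ j<i = trans (inversions-cong (λ k → transpose-comm i j (σ ⟨$⟩ʳ k)))
                           (ValueSwap.swap-permutation j<i σ)


module _ {n d : ℕ} where

  pt-ext : {u v : Pt n d} → (∀ k → lookup u k ≡ lookup v k) → u ≡ v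
  pt-ext {u} {v} u≗v = trans (sym (tabulate∘lookup u)) (trans (tabulate-cong u≗v) (tabulate∘lookup v))

  flipAt : Pt n d → Fin d → Pt n d
  flipAt c k = c [ k ]≔ opposite (lookup c k)

  flip-here : ∀ (c : Pt n d) k → lookup (flipAt c k) k ≡ opposite (lookup c k)
  flip-here c k = lookup∘update k c _

  flip-there : ∀ (c : Pt n d) {j k} → j ≢ k → lookup (flipAt c k) j ≡ lookup c j
  flip-there c j≢k = lookup∘update′ j≢k c _

  flip-involutive : ∀ (c : Pt n d) k → flipAt (flipAt c k) k ≡ c
  flip-involutive c k = begin
    (c [ k ]≔ o) [ k ]≔ opposite (lookup (c [ k ]≔ o) k) ≡⟨ []≔-idempotent c k ⟩
    c [ k ]≔ opposite (lookup (c [ k ]≔ o) k)            ≡⟨ cong (λ v → c [ k ]≔ opposite v) (flip-here c k) ⟩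
    c [ k ]≔ opposite (opposite (lookup c k))            ≡⟨ cong (c [ k ]≔_) (opposite-involutive (lookup c k)) ⟩
    c [ k ]≔ lookup c k                                  ≡⟨ []≔-lookup c k ⟩
    c                                                    ∎
    where
    open ≡-Reasoning
    o = opposite (lookup c k)

  flip-comm : ∀ (c : Pt n d) i j → flipAt (flipAt c i) j ≡ flipAt (flipAt c j) i
  flip-comm c i j with i ≟ j
  ... | yes refl = refl
  ... | no i≢j = begin
    flipAt c i [ j ]≔ opposite (lookup (flipAt c i) j) ≡⟨ cong (λ v → flipAt c i [ j ]≔ opposite v) (flip-there c (i≢j ∘ sym)) ⟩
    (c [ i ]≔ oᵢ) [ j ]≔ oⱼ                            ≡⟨ []≔-commutes c i j i≢j ⟩
    (c [ j ]≔ oⱼ) [ i ]≔ oᵢ                            ≡⟨ cong (λ v → flipAt c j [ i ]≔ opposite v) (flip-there c i≢j) ⟨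
    flipAt c j [ i ]≔ opposite (lookup (flipAt c j) i) ∎
    where
    open ≡-Reasoning
    oᵢ = opposite (lookup c i)
    oⱼ = opposite (lookup c j)

  permute : (Fin d → Fin d) → Pt n d → Pt n d
  permute τ c = tabulate (λ k → lookup c (τ k))

  lookup-permute : ∀ τ (c : Pt n d) k → lookup (permute τ c) k ≡ lookup c (τ k)
  lookup-permute τ c = lookup∘tabulate (λ k → lookup c (τ k))

  permute-cong : ∀ {τ τ′} → (∀ k → τ k ≡ τ′ k) → ∀ (c : Pt n d) → permute τ c ≡ permute τ′ c
  permute-cong τ≗τ′ c = tabulate-cong (cong (lookup c) ∘ τ≗τ′)

  permute-involutive : ∀ {τ} → Involutive _≡_ τ → ∀ (c : Pt n d) → permute τ (permute τ c) ≡ c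
  permute-involutive {τ} invol c = pt-ext λ k → begin
    lookup (permute τ (permute τ c)) k ≡⟨ lookup-permute τ (permute τ c) k ⟩
    lookup (permute τ c) (τ k)         ≡⟨ lookup-permute τ c (τ k) ⟩
    lookup c (τ (τ k))                 ≡⟨ cong (lookup c) (invol k) ⟩
    lookup c k                         ∎
    where open ≡-Reasoning

  permute-flip : ∀ {τ} → Involutive _≡_ τ → ∀ (c : Pt n d) m →
                 permute τ (flipAt c m) ≡ flipAt (permute τ c) (τ m)
  permute-flip {τ} invol c m = pt-ext pointwise
    where
    open ≡-Reasoning
    pointwise : ∀ k → lookup (permute τ (flipAt c m)) k ≡ lookup (flipAt (permute τ c) (τ m)) k
    pointwise k with k ≟ τ m
    ... | yes refl = begin
      lookup (permute τ (flipAt c m)) (τ m) ≡⟨ lookup-permute τ (flipAt c m) (τ m) ⟩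
      lookup (flipAt c m) (τ (τ m))         ≡⟨ cong (lookup (flipAt c m)) (invol m) ⟩
      lookup (flipAt c m) m                 ≡⟨ flip-here c m ⟩
      opposite (lookup c m)                 ≡⟨ cong (opposite ∘ lookup c) (invol m) ⟨
      opposite (lookup c (τ (τ m)))         ≡⟨ cong opposite (lookup-permute τ c (τ m)) ⟨
      opposite (lookup (permute τ c) (τ m)) ≡⟨ flip-here (permute τ c) (τ m) ⟨
      lookup (flipAt (permute τ c) (τ m)) (τ m) ∎
    ... | no k≢τm = begin
      lookup (permute τ (flipAt c m)) k ≡⟨ lookup-permute τ (flipAt c m) k ⟩
      lookup (flipAt c m) (τ k)         ≡⟨ flip-there c (λ τk≡m → k≢τm (trans (sym (invol k)) (cong τ τk≡m))) ⟩
      lookup c (τ k)                    ≡⟨ lookup-permute τ c k ⟨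
      lookup (permute τ c) k            ≡⟨ flip-there (permute τ c) k≢τm ⟨
      lookup (flipAt (permute τ c) (τ m)) k ∎

  permute-replicate : ∀ τ (z : Fin n) → permute τ (replicate d z) ≡ replicate d z
  permute-replicate τ z = pt-ext λ k →
    trans (lookup-permute τ (replicate d z) k) (trans (lookup-replicate (τ k) z) (sym (lookup-replicate k z)))

  R-as-permute : ∀ {i j : Fin d} → i ≢ j → ∀ (x : Pt n d) → R i j x ≡ permute (transpose i j) (flipAt x j)
  R-as-permute {i} {j} i≢j x = pt-ext λ k → trans (pointwise k) (sym (lookup-permute (transpose i j) (flipAt x j) k))
    where
    open ≡-Reasoning
    xᵢ = x [ i ]≔ opposite (lookup x j)
    pointwise : ∀ k → lookup (R i j x) k ≡ lookup (flipAt x j) (transpose i j k)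
    pointwise k with locate i j k
    ... | at-first refl = begin
      lookup (R k j x) k                   ≡⟨ lookup∘update′ i≢j xᵢ (lookup x k) ⟩
      lookup xᵢ k                          ≡⟨ lookup∘update k x _ ⟩
      opposite (lookup x j)                ≡⟨ flip-here x j ⟨
      lookup (flipAt x j) j                ≡⟨ cong (lookup (flipAt x j)) (transpose-left k j) ⟨
      lookup (flipAt x j) (transpose k j k) ∎
    ... | at-second _ refl = begin
      lookup (R i k x) k                   ≡⟨ lookup∘update k xᵢ (lookup x i) ⟩
      lookup x i                           ≡⟨ flip-there x i≢j ⟨
      lookup (flipAt x k) i                ≡⟨ cong (lookup (flipAt x k)) (transpose-right i k) ⟨
      lookup (flipAt x k) (transpose i k k) ∎
    ... | elsewhere k≢i k≢j = begin
      lookup (R i j x) k                   ≡⟨ lookup∘update′ k≢j xᵢ (lookup x i) ⟩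
      lookup xᵢ k                          ≡⟨ lookup∘update′ k≢i x _ ⟩
      lookup x k                           ≡⟨ flip-there x k≢j ⟨
      lookup (flipAt x j) k                ≡⟨ cong (lookup (flipAt x j)) (transpose-other k≢i k≢j) ⟨
      lookup (flipAt x j) (transpose i j k) ∎

  R-flip : ∀ {i j : Fin d} → i ≢ j → ∀ (c : Pt n d) m → R i j (flipAt c m) ≡ flipAt (R i j c) (transpose i j m)
  R-flip {i} {j} i≢j c m = begin
    R i j (flipAt c m)                          ≡⟨ R-as-permute i≢j (flipAt c m) ⟩
    permute τ (flipAt (flipAt c m) j)           ≡⟨ cong (permute τ) (flip-comm c m j) ⟩
    permute τ (flipAt (flipAt c j) m)           ≡⟨ permute-flip (transpose-involutive i j) (flipAt c j) m ⟩
    flipAt (permute τ (flipAt c j)) (τ m)       ≡⟨ cong (λ v → flipAt v (τ m)) (R-as-permute i≢j c) ⟨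
    flipAt (R i j c) (τ m)                      ∎
    where
    open ≡-Reasoning
    τ = transpose i j

  R-inverse : ∀ {i j : Fin d} → i ≢ j → ∀ (x : Pt n d) → R j i (R i j x) ≡ x
  R-inverse {i} {j} i≢j x = begin
    R j i (R i j x)                                ≡⟨ R-as-permute (i≢j ∘ sym) (R i j x) ⟩
    permute τ′ (flipAt (R i j x) i)                ≡⟨ cong (λ v → permute τ′ (flipAt v i)) (R-as-permute i≢j x) ⟩
    permute τ′ (flipAt (permute τ (flipAt x j)) i) ≡⟨ cong (λ m → permute τ′ (flipAt (permute τ (flipAt x j)) m)) (transpose-right i j) ⟨
    permute τ′ (flipAt (permute τ (flipAt x j)) (τ j)) ≡⟨ cong (permute τ′) (permute-flip (transpose-involutive i j) (flipAt x j) j) ⟨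
    permute τ′ (permute τ (flipAt (flipAt x j) j)) ≡⟨ cong (permute τ′ ∘ permute τ) (flip-involutive x j) ⟩
    permute τ′ (permute τ x)                       ≡⟨ permute-cong (transpose-comm j i) (permute τ x) ⟩
    permute τ (permute τ x)                        ≡⟨ permute-involutive (transpose-involutive i j) x ⟩
    x                                              ∎
    where
    open ≡-Reasoning
    τ  = transpose i j
    τ′ = transpose j i

  F-flip : ∀ (π : Permutation′ n) → Symmetric π → ∀ (c : Pt n d) k → F π (flipAt c k) ≡ flipAt (F π c) k
  F-flip π sym-π c k = begin
    map (π ⟨$⟩ʳ_) (c [ k ]≔ opposite (lookup c k))     ≡⟨ map-[]≔ (π ⟨$⟩ʳ_) c k ⟩
    map (π ⟨$⟩ʳ_) c [ k ]≔ (π ⟨$⟩ʳ opposite (lookup c k)) ≡⟨ cong (map (π ⟨$⟩ʳ_) c [ k ]≔_) (sym-π (lookup c k)) ⟩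
    map (π ⟨$⟩ʳ_) c [ k ]≔ opposite (π ⟨$⟩ʳ lookup c k) ≡⟨ cong (λ v → map (π ⟨$⟩ʳ_) c [ k ]≔ opposite v) (lookup-map k _ c) ⟨
    flipAt (F π c) k                                   ∎
    where open ≡-Reasoning

  F-inverse : ∀ (π : Permutation′ n) (x : Pt n d) → F π (F (flip π) x) ≡ x
  F-inverse π x = pt-ext λ k → begin
    lookup (map (π ⟨$⟩ʳ_) (map (π ⟨$⟩ˡ_) x)) k ≡⟨ lookup-map k _ (map (π ⟨$⟩ˡ_) x) ⟩
    π ⟨$⟩ʳ lookup (map (π ⟨$⟩ˡ_) x) k          ≡⟨ cong (π ⟨$⟩ʳ_) (lookup-map k _ x) ⟩
    π ⟨$⟩ʳ (π ⟨$⟩ˡ lookup x k)                  ≡⟨ inverseʳ π ⟩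
    lookup x k                                 ∎
    where open ≡-Reasoning

relabel-injective : ∀ {n} (π : Permutation′ n) {p q} → π ⟨$⟩ʳ p ≡ π ⟨$⟩ʳ q → p ≡ q
relabel-injective π {p} {q} πp≡πq = trans (sym (inverseˡ π)) (trans (cong (π ⟨$⟩ˡ_) πp≡πq) (inverseˡ π))

inverse-symmetric : ∀ {n} (π : Permutation′ n) → Symmetric π → Symmetric (flip π)
inverse-symmetric π sym-π p = relabel-injective π (begin
  π ⟨$⟩ʳ (π ⟨$⟩ˡ opposite p)              ≡⟨ inverseʳ π ⟩
  opposite p                              ≡⟨ cong opposite (inverseʳ π) ⟨
  opposite (π ⟨$⟩ʳ (π ⟨$⟩ˡ p))            ≡⟨ sym-π (π ⟨$⟩ˡ p) ⟨
  π ⟨$⟩ʳ opposite (π ⟨$⟩ˡ p)              ∎)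
  where open ≡-Reasoning

relabel-unfixed : ∀ {n} (π : Permutation′ n) → Symmetric π → ∀ {p} → p ≢ opposite p →
                  π ⟨$⟩ʳ p ≢ opposite (π ⟨$⟩ʳ p)
relabel-unfixed π sym-π p≢p̄ πp≡πp̄ = p≢p̄ (relabel-injective π (trans πp≡πp̄ (sym (sym-π _))))

module _ {n d : ℕ} where

  count : Pt n d → Fin n → Bool
  count c p = sum (λ k → does (lookup c k ≟ p))

  count-replicate : ∀ (z p : Fin n) → count (replicate d z) p ≡ sum {d} (λ _ → does (z ≟ p))
  count-replicate z p = sum-cong-≗ {d} (λ k → cong (λ y → does (y ≟ p)) (lookup-replicate k z))

  TwoValued : Fin n → Pt n d → Set
  TwoValued p c = ∀ k → lookup c k ≡ p ⊎ lookup c k ≡ opposite p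

  count-permute : ∀ (σ : Permutation′ d) (c : Pt n d) p → count (permute (σ ⟨$⟩ʳ_) c) p ≡ count c p
  count-permute σ c p = trans (sum-cong-≗ (λ k → cong (λ y → does (y ≟ p)) (lookup-permute (σ ⟨$⟩ʳ_) c k)))
                              (sym (∑-permute (λ k → does (lookup c k ≟ p)) σ))

  count-flip : ∀ {p} → p ≢ opposite p → ∀ (c : Pt n d) j → (lookup c j ≡ p ⊎ lookup c j ≡ opposite p) →
               count (flipAt c j) p ≡ not (count c p)
  count-flip {p} p≢p̄ c j cⱼ-two = begin
    count (flipAt c j) p
      ≡⟨ sum-update (λ k → does (lookup c k ≟ p)) _ j
                    (λ k k≢j → cong (λ y → does (y ≟ p)) (sym (flip-there c k≢j))) ⟩
    (count c p xor does (cⱼ ≟ p)) xor does (lookup (flipAt c j) j ≟ p)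
      ≡⟨ cong (λ y → (count c p xor does (cⱼ ≟ p)) xor does (y ≟ p)) (flip-here c j) ⟩
    (count c p xor does (cⱼ ≟ p)) xor does (opposite cⱼ ≟ p)
      ≡⟨ xor-assoc (count c p) _ _ ⟩
    count c p xor (does (cⱼ ≟ p) xor does (opposite cⱼ ≟ p))
      ≡⟨ cong (count c p xor_) (exactly-one cⱼ-two) ⟩
    count c p xor true
      ≡⟨ xor-comm (count c p) true ⟩
    not (count c p)
      ∎
    where
    open ≡-Reasoning
    cⱼ = lookup c j
    exactly-one : ∀ {y} → (y ≡ p ⊎ y ≡ opposite p) → does (y ≟ p) xor does (opposite y ≟ p) ≡ true
    exactly-one (inj₁ refl) = cong₂ _xor_ (dec-true (p ≟ p) refl) (dec-false (opposite p ≟ p) (p≢p̄ ∘ sym))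
    exactly-one (inj₂ refl) = cong₂ _xor_ (dec-false (opposite p ≟ p) (p≢p̄ ∘ sym))
                                          (dec-true (opposite (opposite p) ≟ p) (opposite-involutive p))

  two-valued-flip : ∀ {p} (c : Pt n d) → TwoValued p c → ∀ j → TwoValued p (flipAt c j)
  two-valued-flip {p} c two j k with k ≟ j | two k
  ... | yes refl | inj₁ cₖ≡p  = inj₂ (trans (flip-here c k) (cong opposite cₖ≡p))
  ... | yes refl | inj₂ cₖ≡p̄  = inj₁ (trans (flip-here c k) (trans (cong opposite cₖ≡p̄) (opposite-involutive p)))
  ... | no k≢j   | cₖ         = map-⊎ (trans (flip-there c k≢j)) (trans (flip-there c k≢j)) cₖ

  two-valued-permute : ∀ {p} τ (c : Pt n d) → TwoValued p c → TwoValued p (permute τ c)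
  two-valued-permute τ c two k = map-⊎ (trans (lookup-permute τ c k)) (trans (lookup-permute τ c k)) (two (τ k))

  count-R : ∀ {i j : Fin d} → i ≢ j → ∀ {p} → p ≢ opposite p → ∀ (c : Pt n d) → TwoValued p c →
            count (R i j c) p ≡ not (count c p)
  count-R {i} {j} i≢j {p} p≢p̄ c two = begin
    count (R i j c) p                              ≡⟨ cong (λ v → count v p) (R-as-permute i≢j c) ⟩
    count (permute (transpose i j) (flipAt c j)) p ≡⟨ count-permute (transposition i j) (flipAt c j) p ⟩
    count (flipAt c j) p                           ≡⟨ count-flip p≢p̄ c j (two j) ⟩
    not (count c p)                                ∎
    where open ≡-Reasoning

  two-valued-R : ∀ {i j : Fin d} → i ≢ j → ∀ {p} (c : Pt n d) → TwoValued p c → TwoValued p (R i j c)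
  two-valued-R {i} {j} i≢j {p} c two =
    subst (TwoValued p) (sym (R-as-permute i≢j c))
          (two-valued-permute (transpose i j) (flipAt c j) (two-valued-flip c two j))

  count-F : ∀ (π : Permutation′ n) (c : Pt n d) p → count (F π c) (π ⟨$⟩ʳ p) ≡ count c p
  count-F π c p = sum-cong-≗ λ k →
    trans (cong (λ y → does (y ≟ π ⟨$⟩ʳ p)) (lookup-map k _ c))
          (does-⇔ (mk⇔ (relabel-injective π) (cong (π ⟨$⟩ʳ_))) (π ⟨$⟩ʳ lookup c k ≟ π ⟨$⟩ʳ p) (lookup c k ≟ p))

  two-valued-F : ∀ (π : Permutation′ n) → Symmetric π → ∀ {p} (c : Pt n d) → TwoValued p c →
                 TwoValued (π ⟨$⟩ʳ p) (F π c)
  two-valued-F π sym-π {p} c two k with two k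
  ... | inj₁ cₖ≡p = inj₁ (trans (lookup-map k _ c) (cong (π ⟨$⟩ʳ_) cₖ≡p))
  ... | inj₂ cₖ≡p̄ = inj₂ (trans (lookup-map k _ c) (trans (cong (π ⟨$⟩ʳ_) cₖ≡p̄) (sym-π p)))

data Letter (n d : ℕ) : Set where
  rotation : (i j : Fin d) → i ≢ j → Letter n d
  relabel  : (π : Permutation′ n) → Symmetric π → Letter n d

Word : ℕ → ℕ → Set
Word n d = List (Letter n d)

module _ {n d : ℕ} where

  ⟦_⟧ : Letter n d → Map n d
  ⟦ rotation i j _ ⟧ = R i j
  ⟦ relabel π _ ⟧    = F π

  eval : Word n d → Map n d
  eval []      x = x
  eval (l ∷ w) x = ⟦ l ⟧ (eval w x)

  eval-++ : ∀ u v (x : Pt n d) → eval (u ++ v) x ≡ eval u (eval v x)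
  eval-++ []      v x = refl
  eval-++ (l ∷ u) v x = cong ⟦ l ⟧ (eval-++ u v x)

  letter-inverse : Letter n d → Letter n d
  letter-inverse (rotation i j i≢j) = rotation j i (i≢j ∘ sym)
  letter-inverse (relabel π sym-π)  = relabel (flip π) (inverse-symmetric π sym-π)

  letter-inverse-correct : ∀ l (x : Pt n d) → ⟦ l ⟧ (⟦ letter-inverse l ⟧ x) ≡ x
  letter-inverse-correct (rotation i j i≢j) x = R-inverse (i≢j ∘ sym) x
  letter-inverse-correct (relabel π _)      x = F-inverse π x

  word-inverse : Word n d → Word n d
  word-inverse []      = []
  word-inverse (l ∷ w) = word-inverse w ++ (letter-inverse l ∷ [])

  word-inverse-correct : ∀ w (x : Pt n d) → eval w (eval (word-inverse w) x) ≡ x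
  word-inverse-correct []      x = refl
  word-inverse-correct (l ∷ w) x = begin
    ⟦ l ⟧ (eval w (eval (word-inverse w ++ _) x))          ≡⟨ cong (⟦ l ⟧ ∘ eval w) (eval-++ (word-inverse w) _ x) ⟩
    ⟦ l ⟧ (eval w (eval (word-inverse w) (⟦ l⁻¹ ⟧ x)))     ≡⟨ cong ⟦ l ⟧ (word-inverse-correct w (⟦ l⁻¹ ⟧ x)) ⟩
    ⟦ l ⟧ (⟦ l⁻¹ ⟧ x)                                      ≡⟨ letter-inverse-correct l x ⟩
    x                                                      ∎
    where
    open ≡-Reasoning
    l⁻¹ = letter-inverse l

  word-of : ∀ {f} → InGroup n d f → Σ (Word n d) (λ w → f ≈ eval w)
  word-of (gen (genR i j i≢j)) = rotation i j i≢j ∷ [] , λ x → refl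
  word-of (gen (genF π sym-π)) = relabel π sym-π ∷ [] , λ x → refl
  word-of unit                 = [] , λ x → refl
  word-of (comp {f} {g} f∈G g∈G) with word-of f∈G | word-of g∈G
  ... | u , f≈u | v , g≈v = u ++ v , λ x → trans (f≈u (g x)) (trans (cong (eval u) (g≈v x)) (sym (eval-++ u v x)))
  word-of (inv {f} {g} f∈G g∘f≈id _) with word-of f∈G
  ... | w , f≈w = word-inverse w , λ x → begin
    g x                                    ≡⟨ cong g (word-inverse-correct w x) ⟨
    g (eval w (eval (word-inverse w) x))   ≡⟨ cong g (f≈w _) ⟨
    g (f (eval (word-inverse w) x))        ≡⟨ g∘f≈id _ ⟩
    eval (word-inverse w) x                ∎
    where open ≡-Reasoning
  word-of (ext f∈G f≈g) with word-of f∈G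
  ... | w , f≈w = w , λ x → trans (sym (f≈g x)) (f≈w x)

  -- The coordinate permutation of a word: it moves a reflection of the l-th
  -- coordinate to one of the (coordPerm w ⟨$⟩ʳ l)-th coordinate.
  coordPerm : Word n d → Permutation′ d
  coordPerm []                     = id
  coordPerm (rotation i j _ ∷ w)   = coordPerm w ∘ₚ transposition i j
  coordPerm (relabel _ _ ∷ w)      = coordPerm w

  eval-flip : ∀ w (c : Pt n d) l → eval w (flipAt c l) ≡ flipAt (eval w c) (coordPerm w ⟨$⟩ʳ l)
  eval-flip []                       c l = refl
  eval-flip (rotation i j i≢j ∷ w)   c l = trans (cong (R i j) (eval-flip w c l)) (R-flip i≢j (eval w c) _)
  eval-flip (relabel π sym-π ∷ w)    c l = trans (cong (F π) (eval-flip w c l)) (F-flip π sym-π (eval w c) _)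


module Invariant {n d : ℕ} (z : Fin n) (z≢z̄ : z ≢ opposite z) (a : Pt n d) (a-two : TwoValued z a) where

  -- The value p such that every coordinate of w·a is p or its reflection.
  base : Word n d → Fin n
  base []                   = z
  base (rotation _ _ _ ∷ w) = base w
  base (relabel π _ ∷ w)    = π ⟨$⟩ʳ base w

  base-unfixed : ∀ w → base w ≢ opposite (base w)
  base-unfixed []                      = z≢z̄
  base-unfixed (rotation _ _ _ ∷ w)    = base-unfixed w
  base-unfixed (relabel π sym-π ∷ w)   = relabel-unfixed π sym-π (base-unfixed w)

  two-valued : ∀ w → TwoValued (base w) (eval w a)
  two-valued []                        = a-two
  two-valued (rotation i j i≢j ∷ w)    = two-valued-R i≢j (eval w a) (two-valued w)
  two-valued (relabel π sym-π ∷ w)     = two-valued-F π sym-π (eval w a) (two-valued w)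

  -- A rotation flips both the sign of the coordinate permutation and the
  -- count of the base value; a relabelling changes neither.
  invariant : ∀ w → sign (coordPerm w) xor count (eval w a) (base w) ≡ sign (id {n = d}) xor count a z
  invariant [] = refl
  invariant (rotation i j i≢j ∷ w) = begin
    sign (coordPerm w ∘ₚ transposition i j) xor count (R i j (eval w a)) (base w)
      ≡⟨ cong₂ _xor_ (sign-transpose (coordPerm w) i≢j) (count-R i≢j (base-unfixed w) (eval w a) (two-valued w)) ⟩
    not (sign (coordPerm w)) xor not (count (eval w a) (base w))
      ≡⟨ xor-annihilates-not (sign (coordPerm w)) _ ⟩
    sign (coordPerm w) xor count (eval w a) (base w)
      ≡⟨ invariant w ⟩
    sign (id {n = d}) xor count a z ∎
    where open ≡-Reasoning
  invariant (relabel π _ ∷ w) =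
    trans (cong (sign (coordPerm w) xor_) (count-F π (eval w a) (base w))) (invariant w)

sum-const-even : ∀ d → d % 2 ≡ 0 → ∀ b → sum {d} (λ _ → b) ≡ false
sum-const-even zero          _      b = refl
sum-const-even (suc (suc d)) d-even b =
  trans (sym (xor-assoc b b _)) (trans (cong (_xor sum {d} (λ _ → b)) (xor-same b)) (sum-const-even d d-even b))

penultimate ultimate : ∀ e → Fin (suc (suc e))
penultimate zero    = zero
penultimate (suc e) = suc (penultimate e)
ultimate zero    = suc zero
ultimate (suc e) = suc (ultimate e)

penultimate≢ultimate : ∀ e → penultimate e ≢ ultimate e
penultimate≢ultimate zero    ()
penultimate≢ultimate (suc e) = penultimate≢ultimate e ∘ suc-injective

lastSwap : ∀ e → Fin (suc (suc e)) → Fin (suc (suc e))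
lastSwap e = transpose (penultimate e) (ultimate e)

module _ {n : ℕ} where

  X-as-permute : ∀ e (v : Pt n (suc (suc e))) → X v ≡ permute (lastSwap e) v
  X-as-permute e v = pt-ext λ k → trans (pointwise e v k) (sym (lookup-permute (lastSwap e) v k))
    where
    pointwise : ∀ e (v : Pt n (suc (suc e))) k → lookup (X v) k ≡ lookup v (lastSwap e k)
    pointwise zero    (x ∷ y ∷ [])     zero    = refl
    pointwise zero    (x ∷ y ∷ [])     (suc zero) = refl
    pointwise (suc e) (x ∷ y ∷ z ∷ v)  zero    = refl
    pointwise (suc e) (x ∷ y ∷ z ∷ v)  (suc k) =
      trans (pointwise e (y ∷ z ∷ v) k)
            (cong (lookup (x ∷ y ∷ z ∷ v)) (sym (lift₀-transpose (penultimate e) (ultimate e) (suc k))))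

  X-flip : ∀ e (c : Pt n (suc (suc e))) l → X (flipAt c l) ≡ flipAt (X c) (lastSwap e l)
  X-flip e c l = begin
    X (flipAt c l)                          ≡⟨ X-as-permute e (flipAt c l) ⟩
    permute (lastSwap e) (flipAt c l)       ≡⟨ permute-flip {τ = lastSwap e} lastSwap-involutive c l ⟩
    flipAt (permute (lastSwap e) c) (lastSwap e l) ≡⟨ cong (λ v → flipAt v (lastSwap e l)) (X-as-permute e c) ⟨
    flipAt (X c) (lastSwap e l)             ∎
    where
    open ≡-Reasoning
    lastSwap-involutive : Involutive _≡_ (lastSwap e)
    lastSwap-involutive = transpose-involutive (penultimate e) (ultimate e)

flip-injective : ∀ {n d} (c : Pt n d) {k k′} → lookup c k ≢ opposite (lookup c k) →
                 flipAt c k ≡ flipAt c k′ → k ≡ k′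
flip-injective c {k} {k′} cₖ≢c̄ₖ same with k ≟ k′
... | yes k≡k′ = k≡k′
... | no  k≢k′ = ⊥-elim (cₖ≢c̄ₖ (sym (begin
  opposite (lookup c k)    ≡⟨ flip-here c k ⟨
  lookup (flipAt c k) k    ≡⟨ cong (λ v → lookup v k) same ⟩
  lookup (flipAt c k′) k   ≡⟨ flip-there c k≢k′ ⟩
  lookup c k               ∎)))
  where open ≡-Reasoning

-- In even dimension d ≥ 2 (and for n ≥ 2), X is not in the group: as a word
-- it would fix a = (0,…,0), whose counts are all even, while moving
-- reflections by the transposition of the last two coordinates.
X-not-in-group : ∀ n′ e → suc (suc e) % 2 ≡ 0 → ¬ InGroup (suc (suc n′)) (suc (suc e)) X
X-not-in-group n′ e d-even X∈G = not-¬ sign-P≡sign-id sign-P≡not-sign-id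
  where
  d : ℕ
  d = suc (suc e)

  ι : Permutation′ d
  ι = id

  z : Fin (suc (suc n′))
  z = zero

  z≢z̄ : z ≢ opposite z
  z≢z̄ ()

  a : Pt (suc (suc n′)) d
  a = replicate d z

  a-unfixed : ∀ k → lookup a k ≢ opposite (lookup a k)
  a-unfixed k = subst (λ y → y ≢ opposite y) (sym (lookup-replicate k z)) z≢z̄

  open Invariant z z≢z̄ a (λ k → inj₁ (lookup-replicate k z))

  w : Word (suc (suc n′)) d
  w = proj₁ (word-of X∈G)

  X≈w : X ≈ eval w
  X≈w = proj₂ (word-of X∈G)

  P : Permutation′ d
  P = coordPerm w

  X-fixes-a : X a ≡ a
  X-fixes-a = trans (X-as-permute e a) (permute-replicate (lastSwap e) z)

  w-fixes-a : eval w a ≡ a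
  w-fixes-a = trans (sym (X≈w a)) X-fixes-a

  P-is-lastSwap : ∀ l → lastSwap e l ≡ P ⟨$⟩ʳ l
  P-is-lastSwap l = flip-injective a (a-unfixed (lastSwap e l)) (begin
    flipAt a (lastSwap e l)          ≡⟨ cong (λ v → flipAt v (lastSwap e l)) X-fixes-a ⟨
    flipAt (X a) (lastSwap e l)      ≡⟨ X-flip e a l ⟨
    X (flipAt a l)                   ≡⟨ X≈w (flipAt a l) ⟩
    eval w (flipAt a l)              ≡⟨ eval-flip w a l ⟩
    flipAt (eval w a) (P ⟨$⟩ʳ l)     ≡⟨ cong (λ v → flipAt v (P ⟨$⟩ʳ l)) w-fixes-a ⟩
    flipAt a (P ⟨$⟩ʳ l)              ∎)
    where open ≡-Reasoning

  sign-P≡not-sign-id : sign P ≡ not (sign ι)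
  sign-P≡not-sign-id = trans (inversions-cong (sym ∘ P-is-lastSwap))
                             (sign-transpose ι (penultimate≢ultimate e))

  count-a : ∀ p → count a p ≡ false
  count-a p = trans (count-replicate {d = d} z p)
                    (sum-const-even d d-even (does (z ≟ p)))

  sign-P≡sign-id : sign P ≡ sign ι
  sign-P≡sign-id = begin
    sign P                              ≡⟨ xor-identityʳ (sign P) ⟨
    sign P xor false                    ≡⟨ cong (sign P xor_) (count-a (base w)) ⟨
    sign P xor count a (base w)         ≡⟨ cong (λ v → sign P xor count v (base w)) w-fixes-a ⟨
    sign P xor count (eval w a) (base w) ≡⟨ invariant w ⟩
    sign ι xor count a z                ≡⟨ cong (sign ι xor_) (count-a z) ⟩
    sign ι xor false                    ≡⟨ xor-identityʳ (sign ι) ⟩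
    sign ι                              ∎
    where open ≡-Reasoning


record Rotation (d : ℕ) : Set where
  constructor rot
  field
    first second : Fin d
    distinct     : first ≢ second

module _ {n d : ℕ} where

  rotations : List (Rotation d) → Map n d
  rotations []                  x = x
  rotations (rot i j _ ∷ rs)    x = R i j (rotations rs x)

  rotations-in-group : ∀ rs → InGroup n d (rotations rs)
  rotations-in-group []                 = unit
  rotations-in-group (rot i j i≢j ∷ rs) = comp (gen (genR i j i≢j)) (rotations-in-group rs)

shift : ∀ {d} → Rotation d → Rotation (suc d)
shift (rot i j i≢j) = rot (suc i) (suc j) (i≢j ∘ suc-injective)

rotations-shift : ∀ {n d} (rs : List (Rotation d)) (x : Fin n) (v : Pt n d) →
                  rotations (mapList shift rs) (x ∷ v) ≡ x ∷ rotations rs v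
rotations-shift []                 x v = refl
rotations-shift (rot i j _ ∷ rs)   x v = cong (R (suc i) (suc j)) (rotations-shift rs x v)

-- In odd dimension 2 + e, reflecting every coordinate and exchanging the last
-- two is a product of rotations: R₀₁R₀₁ reflects the first two coordinates,
-- and three rotations do the job in dimension 3.
reflect-swap : ∀ e → e % 2 ≡ 1 → List (Rotation (suc (suc e)))
reflect-swap (suc zero)    _   = rot zero (suc (suc zero)) (λ ()) ∷ rot zero (suc (suc zero)) (λ ())
                               ∷ rot (suc zero) (suc (suc zero)) (λ ()) ∷ []
reflect-swap (suc (suc e)) odd = rot zero (suc zero) (λ ()) ∷ rot zero (suc zero) (λ ())
                               ∷ mapList shift (mapList shift (reflect-swap e odd))

reflect-swap-correct : ∀ {n} e (odd : e % 2 ≡ 1) (v : Pt n (suc (suc e))) →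
                       rotations (reflect-swap e odd) v ≡ map opposite (X v)
reflect-swap-correct (suc zero)    _   (x ∷ y ∷ z ∷ []) = refl
reflect-swap-correct {n} (suc (suc e)) odd (x ∷ y ∷ v@(_ ∷ _ ∷ _)) = begin
  R₀₁ (R₀₁ (rotations (mapList shift (mapList shift rs)) (x ∷ y ∷ v)))
    ≡⟨ cong (R₀₁ ∘ R₀₁) (rotations-shift (mapList shift rs) x (y ∷ v)) ⟩
  R₀₁ (R₀₁ (x ∷ rotations (mapList shift rs) (y ∷ v)))
    ≡⟨ cong (λ u → R₀₁ (R₀₁ (x ∷ u))) (rotations-shift rs y v) ⟩
  opposite x ∷ opposite y ∷ rotations rs v
    ≡⟨ cong (λ u → opposite x ∷ opposite y ∷ u) (reflect-swap-correct e odd v) ⟩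
  opposite x ∷ opposite y ∷ map opposite (X v)
    ≡⟨⟩
  map opposite (X (x ∷ y ∷ v))
    ∎
  where
  open ≡-Reasoning
  rs = reflect-swap e odd
  R₀₁ = R {n} {suc (suc (suc (suc e)))} zero (suc zero)

reflect-all-involutive : ∀ {n d} (v : Pt n d) → map opposite (map opposite v) ≡ v
reflect-all-involutive v = pt-ext λ k →
  trans (lookup-map k opposite (map opposite v))
        (trans (cong opposite (lookup-map k opposite v)) (opposite-involutive (lookup v k)))

-- In odd dimension d ≥ 3, X = F_reverse ∘ (product of rotations) is in the group.
X-in-group : ∀ n e → e % 2 ≡ 1 → InGroup n (suc (suc e)) X
X-in-group n e odd =
  ext (comp (gen (genF reverse (λ p → refl))) (rotations-in-group (reflect-swap e odd)))
      (λ v → trans (cong (map opposite) (reflect-swap-correct e odd v)) (reflect-all-involutive (X v)))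

parity : ∀ e → e % 2 ≡ 0 ⊎ e % 2 ≡ 1
parity zero          = inj₁ refl
parity (suc zero)    = inj₂ refl
parity (suc (suc e)) = parity e

-- The theorem; only n ≥ 2 and d ≥ 2 are used.  Since (2 + e) % 2 is e % 2,
-- the two directions are X-not-in-group (for even e) and X-in-group.
lemma10 : ∀ (n d : ℕ) → 3 ≤ n → 2 ≤ d →
          (XContained n d ⇔ d % 2 ≡ 1)
lemma10 n@(suc (suc _)) (suc (suc e)) (s≤s (s≤s _)) (s≤s (s≤s _)) = mk⇔ odd-if-contained contained-if-odd
  where
  odd-if-contained : XContained n (suc (suc e)) → e % 2 ≡ 1
  odd-if-contained (_ , X∈G) with parity e
  ... | inj₁ even = ⊥-elim (X-not-in-group _ e even X∈G)
  ... | inj₂ odd  = odd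

  contained-if-odd : e % 2 ≡ 1 → XContained n (suc (suc e))
  contained-if-odd odd = unit , X-in-group n e odd
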